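{- Up to isomorphism there is exactly one strongly regular configuration with parameters $(16_3;2,2)$.
   Context: A symmetric $(v_k)$ configuration is a finite incidence structure of $v$ points and $v$ lines such that every line has exactly $k$ points, every point lies on exactly $k$ lines, and two distinct points lie on at most one common line. Its point graph has the points as vertices, two distinct points adjacent iff they lie on a common line. A strongly regular configuration with parameters $(v_k;\lambda,\mu)$ is a symmetric $(v_k)$ configuration whose point graph is a strongly regular graph $SRG(v,k(k-1),\lambda,\mu)$ ($v$ vertices, regular of degree $k(k-1)$, adjacent vertices have $\lambda$ common neighbours, distinct non-adjacent vertices have $\mu$ common neighbours). -}

module Defs where

open import Data.Nat using (ℕ; zero; suc; _+_; _*_; _∸_; _≤_)
open import Data.Bool using (Bool; true; false; if_then_else_; _∧_; _∨_; not)
open import Data.Fin using (Fin; zero; suc; _≟_)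
open import Data.Product using (_×_)
open import Relation.Nullary using (¬_)
open import Relation.Nullary.Decidable using (⌊_⌋)
open import Relation.Binary.PropositionalEquality using (_≡_; _≢_)
open import Function.Bundles using (_↔_; Inverse)

count : {n : ℕ} → (Fin n → Bool) → ℕ
count {zero}  f = 0
count {suc n} f = (if f zero then 1 else 0) + count (λ i → f (suc i))

anyFin : {n : ℕ} → (Fin n → Bool) → Bool
anyFin {zero}  f = false
anyFin {suc n} f = f zero ∨ anyFin (λ i → f (suc i))

-- An incidence structure with v points and v lines, both indexed by Fin v;
-- incident p l = true  iff point p lies on line l.
Incidence : ℕ → Set
Incidence v = Fin v → Fin v → Bool

record IsConfiguration (v k : ℕ) (I : Incidence v) : Set where
  field
    line-size  : ∀ (l : Fin v) → count (λ p → I p l) ≡ k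
    point-deg  : ∀ (p : Fin v) → count (λ l → I p l) ≡ k
    at-most-one-line : ∀ (p q : Fin v) → p ≢ q → count (λ l → I p l ∧ I q l) ≤ 1

pointGraph : {v : ℕ} → Incidence v → Fin v → Fin v → Bool
pointGraph I p q = not ⌊ p ≟ q ⌋ ∧ anyFin (λ l → I p l ∧ I q l)

record IsSRG (v d lam mu : ℕ) (adj : Fin v → Fin v → Bool) : Set where
  field
    irreflexive : ∀ x → adj x x ≡ false
    symmetric   : ∀ x y → adj x y ≡ adj y x
    regular     : ∀ x → count (adj x) ≡ d
    adjacent-common : ∀ x y → adj x y ≡ true →
                      count (λ z → adj x z ∧ adj y z) ≡ lam
    nonadjacent-common : ∀ x y → x ≢ y → adj x y ≡ false →
                      count (λ z → adj x z ∧ adj y z) ≡ mu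

record IsSRConfiguration (v k lam mu : ℕ) (I : Incidence v) : Set where
  field
    configuration : IsConfiguration v k I
    srg           : IsSRG v (k * (k ∸ 1)) lam mu (pointGraph I)

record Isomorphic {v : ℕ} (I J : Incidence v) : Set where
  field
    onPoints : Fin v ↔ Fin v
    onLines  : Fin v ↔ Fin v
    preserves : ∀ p l → J (Inverse.to onPoints p) (Inverse.to onLines l) ≡ I p l

-- Since λ = 2, two collinear points x, y have exactly one common neighbour off their line, their
-- apex, and the six neighbours of a point form a hexagon whose sides alternate between lines
-- through the point and apex edges.  So the configuration looks locally like the "upward"
-- triangles {p, p + a, p + b} of the triangular lattice.  A frame (p, ℓ, p + a, p + b), made of a
-- point, a line through it and the other two points of that line, can be moved one step east (in
-- direction a) or north (direction b), and the hexagon at p + a + b shows that the two moves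
-- commute.  The condition μ = 2 closes the lattice up: p and p + 2a have a second common
-- neighbour, which can only be p + 3a, so four steps east (or north) lead back to the same frame.
-- The frames reached from one frame therefore form a copy of the torus configuration on Z₄ × Z₄
-- with lines {p, p + (1, 0), p + (0, 1)}.  The copy is faithful because any two points of the torus
-- lie on a common line or are both collinear with a third point, and the copy keeps apart the points
-- of a line and the lines through a point.

module Submission where

open import Defs
open import Data.Nat using (ℕ; zero; suc; _≤_; z≤n; s≤s)
open import Data.Nat.GeneralisedArithmetic using (fold)
import Data.Nat.Properties as ℕ
open import Data.Bool using (Bool; true; false; if_then_else_; _∧_; _∨_)
open import Data.Bool.Properties as 𝔹 using (∧-comm; ¬-not)
open import Data.Fin using (Fin; zero; suc; _≟_; toℕ; combine; remQuot; punchOut)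
open import Data.Fin.Properties using (all?; any?; remQuot-combine; punchOut-injective; injective⇒≤)
open import Data.Product using (Σ; ∃; _×_; _,_; proj₁; proj₂; uncurry)
open import Data.Sum using (_⊎_; inj₁; inj₂; [_,_]′)
open import Data.Empty using (⊥; ⊥-elim)
open import Function.Bundles using (_↔_; Inverse; mk↔ₛ′)
open import Function.Properties.Inverse using (↔-sym; ↔-trans)
open import Relation.Nullary using (¬_; Dec; yes; no; does)
open import Relation.Nullary.Decidable using (toWitness; ¬?; _→-dec_; _×-dec_; _⊎-dec_)
open import Relation.Binary.PropositionalEquality
  using (_≡_; _≢_; refl; sym; trans; cong; cong₂; subst; subst₂; ≢-sym; module ≡-Reasoning)

_without_ : ∀ {n} → (Fin n → Bool) → Fin n → Fin n → Bool
(f without a) w = if does (w ≟ a) then false else f w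

without-≢ : ∀ {n} (f : Fin n → Bool) {a w} → w ≢ a → (f without a) w ≡ f w
without-≢ f {a} {w} w≢a with w ≟ a
... | yes w≡a = ⊥-elim (w≢a w≡a)
... | no  _   = refl

without-sound : ∀ {n} (f : Fin n → Bool) {a w} → (f without a) w ≡ true → f w ≡ true × w ≢ a
without-sound f {a} {w} e with w ≟ a
... | no w≢a = e , w≢a

count-without : ∀ {n} (f : Fin n → Bool) {a} → f a ≡ true → count f ≡ suc (count (f without a))
count-without {suc n} f {zero}  fa with f zero
count-without {suc n} f {zero}  refl | true = refl
count-without {suc n} f {suc a} fa with f zero
... | true  = cong suc (count-without (λ i → f (suc i)) fa)
... | false = count-without (λ i → f (suc i)) fa

count-without-pred : ∀ {n k} (f : Fin n → Bool) {a} → f a ≡ true → count f ≡ suc k →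
                     count (f without a) ≡ k
count-without-pred f fa c = ℕ.suc-injective (trans (sym (count-without f fa)) c)

count≡0 : ∀ {n} (f : Fin n → Bool) {w} → count f ≡ 0 → f w ≢ true
count≡0 {suc n} f {zero}  c fw rewrite fw with () ← c
count≡0 {suc n} f {suc w} c fw with f zero
count≡0 {suc n} f {suc w} () fw | true
... | false = count≡0 (λ i → f (suc i)) c fw

count-witness : ∀ {n k} (f : Fin n → Bool) → count f ≡ suc k → ∃ λ w → f w ≡ true
count-witness {suc n} f c with f zero in f0
... | true  = zero , f0
... | false = let (w , fw) = count-witness (λ i → f (suc i)) c in suc w , fw

one-of-two : ∀ {n} (f : Fin n → Bool) {a b w} → count f ≡ 2 → f a ≡ true → f b ≡ true → a ≢ b →
             f w ≡ true → w ≡ a ⊎ w ≡ b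
one-of-two f {a} {b} {w} c fa fb a≢b fw with w ≟ a | w ≟ b
... | yes w≡a | _       = inj₁ w≡a
... | no  _   | yes w≡b = inj₂ w≡b
... | no  w≢a | no  w≢b =
  ⊥-elim (count≡0 ((f without a) without b) {w} rest
           (trans (without-≢ (f without a) w≢b) (trans (without-≢ f w≢a) fw)))
  where
  rest : count ((f without a) without b) ≡ 0
  rest = count-without-pred (f without a) (trans (without-≢ f (≢-sym a≢b)) fb) (count-without-pred f fa c)

one-of-three : ∀ {n} (f : Fin n → Bool) {a b c w} → count f ≡ 3 →
               f a ≡ true → f b ≡ true → f c ≡ true → a ≢ b → a ≢ c → b ≢ c →
               f w ≡ true → w ≡ a ⊎ w ≡ b ⊎ w ≡ c
one-of-three f {a} {b} {c} {w} cnt fa fb fc a≢b a≢c b≢c fw with w ≟ a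
... | yes w≡a = inj₁ w≡a
... | no  w≢a = inj₂ (one-of-two (f without a) (count-without-pred f fa cnt)
                         (trans (without-≢ f (≢-sym a≢b)) fb) (trans (without-≢ f (≢-sym a≢c)) fc) b≢c
                         (trans (without-≢ f w≢a) fw))

at-most-one : ∀ {n} (f : Fin n → Bool) {a b} → count f ≤ 1 → f a ≡ true → f b ≡ true → a ≡ b
at-most-one f {a} {b} c fa fb with b ≟ a
... | yes b≡a = sym b≡a
... | no  b≢a = ⊥-elim (count≡0 (f without a) (≤1-pred (subst (_≤ 1) (count-without f fa) c))
                         (trans (without-≢ f b≢a) fb))
  where
  ≤1-pred : ∀ {k} → suc k ≤ 1 → k ≡ 0
  ≤1-pred (s≤s z≤n) = refl

anyFin-intro : ∀ {n} (g : Fin n → Bool) {w} → g w ≡ true → anyFin g ≡ true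
anyFin-intro g {zero}  gw rewrite gw = refl
anyFin-intro g {suc w} gw with g zero
... | true  = refl
... | false = anyFin-intro (λ i → g (suc i)) gw

anyFin-elim : ∀ {n} (g : Fin n → Bool) → anyFin g ≡ true → ∃ λ w → g w ≡ true
anyFin-elim {suc n} g e with g zero in g0
... | true  = zero , g0
... | false = let (w , gw) = anyFin-elim (λ i → g (suc i)) e in suc w , gw

-- The first w with f w ≡ true, and the junk value zero if there is none.
opaque
  choose : ∀ {n} → (Fin (suc n) → Bool) → Fin (suc n)
  choose {zero}  f = zero
  choose {suc n} f = if f zero then zero else suc (choose (λ i → f (suc i)))

  choose-sound : ∀ {n} (f : Fin (suc n) → Bool) {w} → f w ≡ true → f (choose f) ≡ true
  choose-sound {zero}  f {zero} fw = fw
  choose-sound {suc n} f {w} fw with f zero in f0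
  ... | true  = f0
  choose-sound {suc n} f {zero}  fw | false rewrite fw with () ← f0
  choose-sound {suc n} f {suc w} fw | false = choose-sound (λ i → f (suc i)) fw

  choose-cong : ∀ {n} (f g : Fin (suc n) → Bool) → (∀ w → f w ≡ g w) → choose f ≡ choose g
  choose-cong {zero}  f g f≡g = refl
  choose-cong {suc n} f g f≡g rewrite f≡g zero with g zero
  ... | true  = refl
  ... | false = cong suc (choose-cong (λ i → f (suc i)) (λ i → g (suc i)) (λ w → f≡g (suc w)))

choose-count : ∀ {n k} (f : Fin (suc n) → Bool) → count f ≡ suc k → f (choose f) ≡ true
choose-count f c = let (w , fw) = count-witness f c in choose-sound f fw

injective⇒surjective : ∀ {n} (f : Fin n → Fin n) → (∀ {i j} → f i ≡ f j → i ≡ j) →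
                       ∀ y → ∃ λ x → f x ≡ y
injective⇒surjective {suc m} f f-injective y with any? (λ x → f x ≟ y)
... | yes found = found
... | no  none  = ⊥-elim (ℕ.n≮n m (injective⇒≤ g-injective))
  where
  avoids : ∀ x → y ≢ f x
  avoids x y≡fx = none (x , sym y≡fx)
  g : Fin (suc m) → Fin m
  g x = punchOut (avoids x)
  g-injective : ∀ {i j} → g i ≡ g j → i ≡ j
  g-injective {i} {j} gi≡gj = f-injective (punchOut-injective (avoids i) (avoids j) gi≡gj)

injective⇒↔ : ∀ {n} (f : Fin n → Fin n) → (∀ {i j} → f i ≡ f j → i ≡ j) → Fin n ↔ Fin n
injective⇒↔ f f-injective = mk↔ₛ′ f (λ y → proj₁ (surjective y)) (λ y → proj₂ (surjective y))
                                    (λ x → f-injective (proj₂ (surjective (f x))))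
  where
  surjective = injective⇒surjective f f-injective

injective-on-three : ∀ {A B : Set} (g : A → B) {a b c u v} → g a ≢ g b → g a ≢ g c → g b ≢ g c →
                     u ≡ a ⊎ u ≡ b ⊎ u ≡ c → v ≡ a ⊎ v ≡ b ⊎ v ≡ c → g u ≡ g v → u ≡ v
injective-on-three g a≢b a≢c b≢c (inj₁ refl)        (inj₁ refl)        e = refl
injective-on-three g a≢b a≢c b≢c (inj₁ refl)        (inj₂ (inj₁ refl)) e = ⊥-elim (a≢b e)
injective-on-three g a≢b a≢c b≢c (inj₁ refl)        (inj₂ (inj₂ refl)) e = ⊥-elim (a≢c e)
injective-on-three g a≢b a≢c b≢c (inj₂ (inj₁ refl)) (inj₁ refl)        e = ⊥-elim (a≢b (sym e))
injective-on-three g a≢b a≢c b≢c (inj₂ (inj₁ refl)) (inj₂ (inj₁ refl)) e = refl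
injective-on-three g a≢b a≢c b≢c (inj₂ (inj₁ refl)) (inj₂ (inj₂ refl)) e = ⊥-elim (b≢c e)
injective-on-three g a≢b a≢c b≢c (inj₂ (inj₂ refl)) (inj₁ refl)        e = ⊥-elim (a≢c (sym e))
injective-on-three g a≢b a≢c b≢c (inj₂ (inj₂ refl)) (inj₂ (inj₁ refl)) e = ⊥-elim (b≢c (sym e))
injective-on-three g a≢b a≢c b≢c (inj₂ (inj₂ refl)) (inj₂ (inj₂ refl)) e = refl

∧-intro : ∀ {a b} → a ≡ true → b ≡ true → a ∧ b ≡ true
∧-intro refl refl = refl

∧-elim : ∀ {a b} → a ∧ b ≡ true → a ≡ true × b ≡ true
∧-elim {true} {true} refl = refl , refl

Isomorphic-sym : ∀ {v} {I J : Incidence v} → Isomorphic I J → Isomorphic J I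
Isomorphic-sym {J = J} iso = record
  { onPoints  = ↔-sym onPoints
  ; onLines   = ↔-sym onLines
  ; preserves = λ p l → trans (sym (preserves (from onPoints p) (from onLines l)))
                              (cong₂ J (strictlyInverseˡ onPoints p) (strictlyInverseˡ onLines l))
  }
  where
  open Isomorphic iso
  open Inverse

Isomorphic-trans : ∀ {v} {I J K : Incidence v} → Isomorphic I J → Isomorphic J K → Isomorphic I K
Isomorphic-trans iso₁ iso₂ = record
  { onPoints  = ↔-trans (onPoints iso₁) (onPoints iso₂)
  ; onLines   = ↔-trans (onLines iso₁) (onLines iso₂)
  ; preserves = λ p l → trans (preserves iso₂ _ _) (preserves iso₁ p l)
  }
  where open Isomorphic

-- Local geometry of a strongly regular (v₃; 2, 2) configuration

module Geometry {n : ℕ} (I : Incidence (suc n)) (C : IsSRConfiguration (suc n) 3 2 2 I) where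
  open IsSRConfiguration C
  open IsConfiguration configuration
  open IsSRG srg

  Point Line : Set
  Point = Fin (suc n)
  Line  = Fin (suc n)

  infix 4 _∈_ _∉_ _~_ _≁_

  _∈_ : Point → Line → Set
  p ∈ l = I p l ≡ true

  _∉_ : Point → Line → Set
  p ∉ l = ¬ p ∈ l

  _~_ : Point → Point → Set
  x ~ y = pointGraph I x y ≡ true

  _≁_ : Point → Point → Set
  x ≁ y = ¬ x ~ y

  ~-sym : ∀ {x y} → x ~ y → y ~ x
  ~-sym {x} {y} x~y = trans (symmetric y x) x~y

  ~⇒≢ : ∀ {x y} → x ~ y → x ≢ y
  ~⇒≢ {x} x~x refl with () ← trans (sym x~x) (irreflexive x)

  collinear⇒~ : ∀ {x y l} → x ∈ l → y ∈ l → x ≢ y → x ~ y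
  collinear⇒~ {x} {y} x∈l y∈l x≢y with x ≟ y
  ... | yes x≡y = ⊥-elim (x≢y x≡y)
  ... | no  _   = anyFin-intro (λ l → I x l ∧ I y l) (∧-intro x∈l y∈l)

  ~⇒collinear : ∀ {x y} → x ~ y → ∃ λ l → x ∈ l × y ∈ l
  ~⇒collinear {x} {y} x~y with x ≟ y
  ... | no _ = let (l , e) = anyFin-elim (λ l → I x l ∧ I y l) x~y in l , ∧-elim e

  line-unique : ∀ {x y l m} → x ≢ y → x ∈ l → y ∈ l → x ∈ m → y ∈ m → l ≡ m
  line-unique {x} {y} x≢y x∈l y∈l x∈m y∈m =
    at-most-one (λ l → I x l ∧ I y l) (at-most-one-line x y x≢y) (∧-intro x∈l y∈l) (∧-intro x∈m y∈m)

  off-second-line : ∀ {x y l m} → l ≢ m → x ∈ l → x ∈ m → y ∈ l → y ≢ x → y ∉ m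
  off-second-line l≢m x∈l x∈m y∈l y≢x y∈m = l≢m (line-unique (≢-sym y≢x) x∈l y∈l x∈m y∈m)

  record OnLine (l : Line) (a b c : Point) : Set where
    field
      a∈  : a ∈ l
      b∈  : b ∈ l
      c∈  : c ∈ l
      a≢b : a ≢ b
      a≢c : a ≢ c
      b≢c : b ≢ c

    a~b : a ~ b
    a~b = collinear⇒~ a∈ b∈ a≢b

    a~c : a ~ c
    a~c = collinear⇒~ a∈ c∈ a≢c

    b~c : b ~ c
    b~c = collinear⇒~ b∈ c∈ b≢c

  rotate : ∀ {l a b c} → OnLine l a b c → OnLine l b c a
  rotate o = record { a∈ = b∈ ; b∈ = c∈ ; c∈ = a∈
                    ; a≢b = b≢c ; a≢c = ≢-sym a≢b ; b≢c = ≢-sym a≢c }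
    where open OnLine o

  exchange : ∀ {l a b c} → OnLine l a b c → OnLine l a c b
  exchange o = record { a∈ = a∈ ; b∈ = c∈ ; c∈ = b∈
                      ; a≢b = a≢c ; a≢c = a≢b ; b≢c = ≢-sym b≢c }
    where open OnLine o

  on-line : ∀ {l a b c w} → OnLine l a b c → w ∈ l → w ≡ a ⊎ w ≡ b ⊎ w ≡ c
  on-line {l} o = one-of-three (λ p → I p l) (line-size l) a∈ b∈ c∈ a≢b a≢c b≢c
    where open OnLine o

  on-line-last : ∀ {l a b c w} → OnLine l a b c → w ∈ l → w ≢ a → w ≢ b → w ≡ c
  on-line-last o w∈l w≢a w≢b =
    [ (λ w≡a → ⊥-elim (w≢a w≡a)) , [ (λ w≡b → ⊥-elim (w≢b w≡b)) , (λ w≡c → w≡c) ]′ ]′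
      (on-line o w∈l)

  off-line : ∀ {l a b c w} → OnLine l a b c → w ≢ a → w ≢ b → w ≢ c → w ∉ l
  off-line o w≢a w≢b w≢c w∈l = w≢c (on-line-last o w∈l w≢a w≢b)

  on-last-line : ∀ {x y l₁ l₂ l₃} → x ∈ l₁ → x ∈ l₂ → x ∈ l₃ → l₁ ≢ l₂ → l₁ ≢ l₃ →
                 l₂ ≢ l₃ → y ~ x → y ∉ l₁ → y ∉ l₂ → y ∈ l₃
  on-last-line {x} {y} x∈l₁ x∈l₂ x∈l₃ l₁≢l₂ l₁≢l₃ l₂≢l₃ y~x y∉l₁ y∉l₂
    with ~⇒collinear y~x
  ... | m , y∈m , x∈m
    with one-of-three (I x) (point-deg x) x∈l₁ x∈l₂ x∈l₃ l₁≢l₂ l₁≢l₃ l₂≢l₃ x∈m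
  ... | inj₁ refl        = ⊥-elim (y∉l₁ y∈m)
  ... | inj₂ (inj₁ refl) = ⊥-elim (y∉l₂ y∈m)
  ... | inj₂ (inj₂ refl) = y∈m

  common : Point → Point → Point → Bool
  common x y w = pointGraph I x w ∧ pointGraph I y w

  common-count : ∀ {x y} → x ≢ y → count (common x y) ≡ 2
  common-count {x} {y} x≢y with pointGraph I x y in x~?y
  ... | true  = adjacent-common x y x~?y
  ... | false = nonadjacent-common x y x≢y x~?y

  no-three-common : ∀ {x y a b c} → x ≢ y → a ≢ b → a ≢ c → b ≢ c →
                    a ~ x → a ~ y → b ~ x → b ~ y → c ~ x → c ~ y → ⊥
  no-three-common {x} {y} x≢y a≢b a≢c b≢c a~x a~y b~x b~y c~x c~y =
    [ (λ c≡a → a≢c (sym c≡a)) , (λ c≡b → b≢c (sym c≡b)) ]′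
      (one-of-two (common x y) (common-count x≢y) (both a~x a~y) (both b~x b~y) a≢b (both c~x c~y))
    where
    both : ∀ {w} → w ~ x → w ~ y → common x y w ≡ true
    both w~x w~y = ∧-intro (~-sym w~x) (~-sym w~y)

  opaque
    third : Line → Point → Point → Point
    third l a b = choose (((λ p → I p l) without a) without b)

    third-spec : ∀ {l a b} → a ∈ l → b ∈ l → a ≢ b → OnLine l a b (third l a b)
    third-spec {l} {a} {b} a∈l b∈l a≢b = record
      { a∈ = a∈l ; b∈ = b∈l ; c∈ = proj₁ c-facts ; a≢b = a≢b
      ; a≢c = λ a≡c → proj₂ c-facts (sym a≡c) ; b≢c = λ b≡c → proj₂ chosen (sym b≡c) }
      where
      on : Point → Bool
      on p = I p l
      rest : count ((on without a) without b) ≡ 1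
      rest = count-without-pred (on without a) (trans (without-≢ on (≢-sym a≢b)) b∈l)
               (count-without-pred on a∈l (line-size l))
      chosen : (on without a) (third l a b) ≡ true × third l a b ≢ b
      chosen = without-sound (on without a) (choose-count ((on without a) without b) rest)
      c-facts : third l a b ∈ l × third l a b ≢ a
      c-facts = without-sound on (proj₁ chosen)

    lineThrough : Point → Point → Line
    lineThrough x y = choose (λ l → I x l ∧ I y l)

    lineThrough-spec : ∀ {x y} → x ~ y → x ∈ lineThrough x y × y ∈ lineThrough x y
    lineThrough-spec {x} {y} x~y =
      let (l , x∈l , y∈l) = ~⇒collinear x~y
      in ∧-elim (choose-sound (λ l → I x l ∧ I y l) (∧-intro x∈l y∈l))

    apex : Point → Point → Point → Point
    apex x y z = choose (common x y without z)

    apex-spec : ∀ {x y z} → x ≢ y → z ~ x → z ~ y → apex x y z ~ x × apex x y z ~ y × apex x y z ≢ z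
    apex-spec {x} {y} {z} x≢y z~x z~y =
      let (common-xy , a≢z) = without-sound (common x y)
                                (choose-count (common x y without z)
                                  (count-without-pred (common x y) (∧-intro (~-sym z~x) (~-sym z~y))
                                                      (common-count x≢y)))
          (x~a , y~a) = ∧-elim common-xy
      in ~-sym x~a , ~-sym y~a , a≢z

    apex-comm : ∀ x y z → apex x y z ≡ apex y x z
    apex-comm x y z = choose-cong (common x y without z) (common y x without z) same
      where
      same : ∀ w → (common x y without z) w ≡ (common y x without z) w
      same w with does (w ≟ z)
      ... | true  = refl
      ... | false = ∧-comm (pointGraph I x w) (pointGraph I y w)

  third-unique : ∀ {l a b c} → OnLine l a b c → third l a b ≡ c
  third-unique o = on-line-last o (OnLine.c∈ t) (≢-sym (OnLine.a≢c t)) (≢-sym (OnLine.b≢c t))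
    where t = third-spec (OnLine.a∈ o) (OnLine.b∈ o) (OnLine.a≢b o)

  record Apex (l : Line) (x y e : Point) : Set where
    field
      e~x : e ~ x
      e~y : e ~ y
      e∉l : e ∉ l

  Apex-swap : ∀ {l x y e} → Apex l x y e → Apex l y x e
  Apex-swap A = record { e~x = e~y ; e~y = e~x ; e∉l = e∉l }
    where open Apex A

  apex-of-line : ∀ {l x y z} → OnLine l x y z → Apex l x y (apex x y z)
  apex-of-line o = record { e~x = e~x ; e~y = e~y ; e∉l = off-line o (~⇒≢ e~x) (~⇒≢ e~y) e≢z }
    where
    open OnLine o
    e-facts = apex-spec a≢b (~-sym a~c) (~-sym b~c)
    e~x = proj₁ e-facts
    e~y = proj₁ (proj₂ e-facts)
    e≢z = proj₂ (proj₂ e-facts)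

  apex-unique : ∀ {l x y u w} → x ∈ l → y ∈ l → x ~ y → Apex l x y u → Apex l x y w → u ≡ w
  apex-unique {l} {x} {y} {u} {w} x∈l y∈l x~y U W with u ≟ w
  ... | yes u≡w = u≡w
  ... | no  u≢w = ⊥-elim (no-three-common (~⇒≢ x~y) (λ t≡u → U.e∉l (subst (_∈ l) t≡u c∈))
                            (λ t≡w → W.e∉l (subst (_∈ l) t≡w c∈)) u≢w
                            (~-sym a~c) (~-sym b~c) U.e~x U.e~y W.e~x W.e~y)
    where
    open OnLine (third-spec x∈l y∈l (~⇒≢ x~y))
    module U = Apex U
    module W = Apex W

  apex-≁-third : ∀ {l a b c w} → OnLine l a b c → Apex l a b w → w ≁ c
  apex-≁-third {l} {a} {b} {c} {w} o W w~c =
    b≢c (apex-unique a∈m w∈m (~-sym W.e~x)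
           (record { e~x = ~-sym a~b ; e~y = ~-sym W.e~y ; e∉l = off b∈ a≢b })
           (record { e~x = ~-sym a~c ; e~y = ~-sym w~c ; e∉l = off c∈ a≢c }))
    where
    open OnLine o
    module W = Apex W
    m = proj₁ (~⇒collinear (~-sym W.e~x))
    a∈m = proj₁ (proj₂ (~⇒collinear (~-sym W.e~x)))
    w∈m = proj₂ (proj₂ (~⇒collinear (~-sym W.e~x)))
    off : ∀ {p} → p ∈ l → a ≢ p → p ∉ m
    off p∈l a≢p p∈m = W.e∉l (subst (w ∈_) (sym (line-unique a≢p a∈ p∈l a∈m p∈m)) w∈m)

  apex-off-other-line : ∀ {x a₁ b₁ a₂ b₂ l₁ l₂} →
                        OnLine l₁ x a₁ b₁ → OnLine l₂ x a₂ b₂ → l₁ ≢ l₂ → b₁ ~ a₂ → apex x a₁ b₁ ∉ l₂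
  apex-off-other-line {x} {a₁} {b₁} {a₂} {b₂} {l₁} {l₂} o₁ o₂ l₁≢l₂ b₁~a₂ =
    off-line o₂ (~⇒≢ E.e~x) e≢a₂ e≢b₂
    where
    module O₁ = OnLine o₁
    module O₂ = OnLine o₂
    module E = Apex (apex-of-line o₁)
    off-l₁ : ∀ {p} → p ∈ l₂ → p ≢ x → p ∉ l₁
    off-l₁ p∈l₂ p≢x = off-second-line (≢-sym l₁≢l₂) O₂.a∈ O₁.a∈ p∈l₂ p≢x
    e≢a₂ : apex x a₁ b₁ ≢ a₂
    e≢a₂ e≡a₂ = apex-≁-third o₁ a₂-apex (~-sym b₁~a₂)
      where
      a₂-apex = record { e~x = ~-sym O₂.a~b ; e~y = subst (_~ a₁) e≡a₂ E.e~y
                       ; e∉l = off-l₁ O₂.b∈ (≢-sym O₂.a≢b) }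
    -- otherwise x, b₁ and b₂ would be three common neighbours of a₁ and a₂
    e≢b₂ : apex x a₁ b₁ ≢ b₂
    e≢b₂ e≡b₂ = no-three-common a₁≢a₂ O₁.a≢c O₂.a≢c b₁≢b₂
                  O₁.a~b O₂.a~b (~-sym O₁.b~c) b₁~a₂ (subst (_~ a₁) e≡b₂ E.e~y) (~-sym O₂.b~c)
      where
      a₁≢a₂ : a₁ ≢ a₂
      a₁≢a₂ refl = off-l₁ O₂.b∈ (≢-sym O₂.a≢b) O₁.b∈
      b₁≢b₂ : b₁ ≢ b₂
      b₁≢b₂ refl = off-l₁ O₂.c∈ (≢-sym O₂.a≢c) O₁.c∈

  -- The six neighbours of x form a hexagon in which the pairs on a line through x alternate with the
  -- pairs {a, e}, e the apex of x and a.
  hexagon : ∀ {x a₁ b₁ a₂ b₂ l₁ l₂} → OnLine l₁ x a₁ b₁ → OnLine l₂ x a₂ b₂ → l₁ ≢ l₂ → b₁ ~ a₂ →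
            let e = apex x a₁ b₁ ; f = apex x b₂ a₂ ; l₃ = lineThrough x e in
            OnLine l₃ x e f × l₃ ≢ l₁ × l₃ ≢ l₂
  hexagon {x} {a₁} {b₁} {a₂} {b₂} {l₁} {l₂} o₁ o₂ l₁≢l₂ b₁~a₂ =
    record { a∈ = x∈l₃ ; b∈ = e∈l₃ ; c∈ = f∈l₃
           ; a≢b = ≢-sym (~⇒≢ E.e~x) ; a≢c = ≢-sym (~⇒≢ F.e~x) ; b≢c = e≢f } ,
    l₃≢l₁ , l₃≢l₂
    where
    module O₁ = OnLine o₁
    module O₂ = OnLine o₂
    module E = Apex (apex-of-line o₁)
    module F = Apex (apex-of-line (exchange o₂))
    e = apex x a₁ b₁
    f = apex x b₂ a₂
    l₃ = lineThrough x e
    x∈l₃ = proj₁ (lineThrough-spec (~-sym E.e~x))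
    e∈l₃ = proj₂ (lineThrough-spec (~-sym E.e~x))
    l₃≢l₁ : l₃ ≢ l₁
    l₃≢l₁ l₃≡l₁ = E.e∉l (subst (e ∈_) l₃≡l₁ e∈l₃)
    l₃≢l₂ : l₃ ≢ l₂
    l₃≢l₂ l₃≡l₂ = apex-off-other-line o₁ o₂ l₁≢l₂ b₁~a₂ (subst (e ∈_) l₃≡l₂ e∈l₃)
    f∉l₁ : f ∉ l₁
    f∉l₁ = apex-off-other-line (exchange o₂) (exchange o₁) (≢-sym l₁≢l₂) (~-sym b₁~a₂)
    f∈l₃ : f ∈ l₃
    f∈l₃ = on-last-line O₁.a∈ O₂.a∈ x∈l₃ l₁≢l₂ (≢-sym l₃≢l₁) (≢-sym l₃≢l₂) F.e~x
                        f∉l₁ F.e∉l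
    e≢f : e ≢ f
    e≢f e≡f = off-second-line l₁≢l₂ O₁.a∈ O₂.a∈ O₁.b∈ (≢-sym O₁.a≢b)
                              (subst (_∈ l₂) (sym a₁≡b₂) O₂.c∈)
      where
      a₁-apex : Apex l₃ x e a₁
      a₁-apex = record { e~x = ~-sym O₁.a~b ; e~y = ~-sym E.e~y
                       ; e∉l = off-second-line (≢-sym l₃≢l₁) O₁.a∈ x∈l₃ O₁.b∈ (≢-sym O₁.a≢b)
                       }
      b₂-apex : Apex l₃ x e b₂
      b₂-apex = record { e~x = ~-sym O₂.a~c ; e~y = ~-sym (subst (_~ b₂) (sym e≡f) F.e~y)
                       ; e∉l = off-second-line (≢-sym l₃≢l₂) O₂.a∈ x∈l₃ O₂.c∈ (≢-sym O₂.a≢c)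
                       }
      a₁≡b₂ : a₁ ≡ b₂
      a₁≡b₂ = apex-unique x∈l₃ e∈l₃ (~-sym E.e~x) a₁-apex b₂-apex

  -- A frame (x, ℓ, p, q) stands for a point i of the torus together with the line based at i and
  -- the other two points i + (1, 0), i + (0, 1) of that line.
  record Frame : Set where
    constructor frame
    field
      origin : Point
      line   : Line
      east   : Point
      north  : Point
  open Frame public

  Valid : Frame → Set
  Valid F = OnLine (line F) (origin F) (east F) (north F)

  stepEast : Frame → Frame
  stepEast (frame x l p q) = frame p (lineThrough p r) (third (lineThrough p r) p r) r
    where r = apex p q x

  flip : Frame → Frame
  flip (frame x l p q) = frame x l q p

  stepNorth : Frame → Frame
  stepNorth F = flip (stepEast (flip F))

  stepEast-valid : ∀ {F} → Valid F → Valid (stepEast F)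
  stepEast-valid o =
    exchange (third-spec (proj₁ (lineThrough-spec p~r)) (proj₂ (lineThrough-spec p~r)) (~⇒≢ p~r))
    where p~r = ~-sym (Apex.e~x (apex-of-line (rotate o)))

  stepNorth-valid : ∀ {F} → Valid F → Valid (stepNorth F)
  stepNorth-valid o = exchange (stepEast-valid (exchange o))

  frame-≡ : ∀ {x x′ l l′ p p′ q q′} → x ≡ x′ → l ≡ l′ → p ≡ p′ → q ≡ q′ →
            frame x l p q ≡ frame x′ l′ p′ q′
  frame-≡ refl refl refl refl = refl

  module Square {F : Frame} (o : Valid F) where
    open ≡-Reasoning

    x = origin F ; p = east F ; q = north F
    r = apex p q x
    N = frame q (lineThrough q r) r (third (lineThrough q r) q r)
    l₁ = line (stepEast F)
    l₂ = line N
    p₂ = east (stepEast F)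
    q₂ = north N
    s = apex r p₂ p
    t = apex r q₂ q
    L₃ = lineThrough r s

    stepNorth≡N : stepNorth F ≡ N
    stepNorth≡N = cong (λ u → frame q (lineThrough q u) u (third (lineThrough q u) q u)) (apex-comm q p x)

    o₁ : OnLine l₁ r p₂ p
    o₁ = exchange (rotate (rotate (stepEast-valid o)))

    o₂ : OnLine l₂ r q q₂
    o₂ = exchange (rotate (subst Valid stepNorth≡N (stepNorth-valid o)))

    l₁≢l₂ : l₁ ≢ l₂
    l₁≢l₂ l₁≡l₂ = Apex.e∉l (apex-of-line (rotate o)) (subst (r ∈_) l₁≡l (OnLine.a∈ o₁))
      where
      l₁≡l : l₁ ≡ line F
      l₁≡l = line-unique (OnLine.b≢c o) (OnLine.c∈ o₁) (subst (q ∈_) (sym l₁≡l₂) (OnLine.b∈ o₂))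
                         (OnLine.b∈ o) (OnLine.c∈ o)

    hex = hexagon o₁ o₂ l₁≢l₂ (OnLine.b~c o)

    trio : OnLine L₃ r s t
    trio = proj₁ hex

    L₄≡L₃ : lineThrough r t ≡ L₃
    L₄≡L₃ = line-unique (OnLine.a≢c trio) (proj₁ (lineThrough-spec r~t)) (proj₂ (lineThrough-spec r~t))
                        (OnLine.a∈ trio) (OnLine.c∈ trio)
      where r~t = OnLine.a~c trio

    commute : stepEast (stepNorth F) ≡ stepNorth (stepEast F)
    commute = begin
      stepEast (stepNorth F)
        ≡⟨ cong stepEast stepNorth≡N ⟩
      frame r (lineThrough r t) (third (lineThrough r t) r t) t
        ≡⟨ cong (λ m → frame r m (third m r t) t) L₄≡L₃ ⟩
      frame r L₃ (third L₃ r t) t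
        ≡⟨ frame-≡ refl refl (third-unique (exchange trio)) (sym (third-unique trio)) ⟩
      stepNorth (stepEast F)
        ∎

    lines-distinct : l₁ ≢ line (stepNorth F) × line (stepEast (stepNorth F)) ≢ l₁
                     × line (stepEast (stepNorth F)) ≢ line (stepNorth F)
    lines-distinct = subst (l₁ ≢_) (sym l≡l₂) l₁≢l₂ ,
                     subst (_≢ l₁) (sym L≡L₃) (proj₁ (proj₂ hex)) ,
                     subst₂ _≢_ (sym L≡L₃) (sym l≡l₂) (proj₂ (proj₂ hex))
      where
      l≡l₂ : line (stepNorth F) ≡ l₂
      l≡l₂ = cong line stepNorth≡N
      L≡L₃ : line (stepEast (stepNorth F)) ≡ L₃
      L≡L₃ = cong line commute

  steps-commute : ∀ {F} → Valid F → stepEast (stepNorth F) ≡ stepNorth (stepEast F)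
  steps-commute o = Square.commute o

  square-lines-distinct : ∀ {F} → Valid F →
                          line (stepEast F) ≢ line (stepNorth F)
                          × line (stepEast (stepNorth F)) ≢ line (stepEast F)
                          × line (stepEast (stepNorth F)) ≢ line (stepNorth F)
  square-lines-distinct o = Square.lines-distinct o

  module Strip {x₀ x₁ x₂ x₃ x₄ y₀ y₁ y₂ y₃ : Point} {L₀ L₁ L₂ L₃ : Line}
               (o₀ : OnLine L₀ x₀ x₁ y₀) (o₁ : OnLine L₁ x₁ x₂ y₁)
               (o₂ : OnLine L₂ x₂ x₃ y₂) (o₃ : OnLine L₃ x₃ x₄ y₃)
               (y₁≡ : y₁ ≡ apex x₁ y₀ x₀) (y₂≡ : y₂ ≡ apex x₂ y₁ x₁)
               (y₃≡ : y₃ ≡ apex x₃ y₂ x₂) where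
    module O₀ = OnLine o₀
    module O₁ = OnLine o₁
    module O₂ = OnLine o₂
    module O₃ = OnLine o₃

    Y₁ : Apex L₀ x₁ y₀ y₁
    Y₁ = subst (Apex L₀ x₁ y₀) (sym y₁≡) (apex-of-line (rotate o₀))
    Y₂ : Apex L₁ x₂ y₁ y₂
    Y₂ = subst (Apex L₁ x₂ y₁) (sym y₂≡) (apex-of-line (rotate o₁))
    Y₃ : Apex L₂ x₃ y₂ y₃
    Y₃ = subst (Apex L₂ x₃ y₂) (sym y₃≡) (apex-of-line (rotate o₂))
    module Y₁ = Apex Y₁
    module Y₂ = Apex Y₂
    module Y₃ = Apex Y₃

    L₁≢L₀ : L₁ ≢ L₀
    L₁≢L₀ L₁≡L₀ = Y₁.e∉l (subst (y₁ ∈_) L₁≡L₀ O₁.c∈)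
    L₂≢L₁ : L₂ ≢ L₁
    L₂≢L₁ L₂≡L₁ = Y₂.e∉l (subst (y₂ ∈_) L₂≡L₁ O₂.c∈)
    L₂≢L₃ : L₂ ≢ L₃
    L₂≢L₃ L₂≡L₃ = Y₃.e∉l (subst (y₃ ∈_) (sym L₂≡L₃) O₃.c∈)

    m₀ = apex x₁ x₀ y₀
    m₁ = apex x₁ x₂ y₁
    m₂ = apex x₂ x₃ y₂
    M₁ = lineThrough x₁ m₁
    M₂ = lineThrough x₂ m₂
    M₃ = lineThrough x₃ (apex x₃ x₂ y₂)
    Am₀ : Apex L₀ x₁ x₀ m₀
    Am₀ = apex-of-line (exchange (rotate o₀))
    Am₁ : Apex L₁ x₁ x₂ m₁
    Am₁ = apex-of-line o₁
    module Am₀ = Apex Am₀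
    module Am₁ = Apex Am₁

    hex₁ = hexagon o₁ (rotate o₀) L₁≢L₀ Y₁.e~y
    hex₂ = hexagon o₂ (rotate o₁) L₂≢L₁ Y₂.e~y
    hex₃ = hexagon (exchange (rotate o₂)) (exchange o₃) L₂≢L₃ (~-sym Y₃.e~y)

    star₁ : OnLine M₁ x₁ m₁ m₀
    star₁ = proj₁ hex₁
    star₂ : OnLine M₂ x₂ m₂ m₁
    star₂ = subst (OnLine M₂ x₂ m₂) (apex-comm x₂ x₁ y₁) (proj₁ hex₂)
    star₃ : OnLine M₃ x₃ m₂ (apex x₃ x₄ y₃)
    star₃ = subst (λ u → OnLine M₃ x₃ u (apex x₃ x₄ y₃)) (apex-comm x₃ x₂ y₂) (proj₁ hex₃)
    module S₁ = OnLine star₁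
    module S₂ = OnLine star₂

    M₁≢L₁ = proj₁ (proj₂ hex₁)
    M₁≢L₀ = proj₂ (proj₂ hex₁)
    M₂≢L₂ = proj₁ (proj₂ hex₂)
    M₂≢L₁ = proj₂ (proj₂ hex₂)
    M₃≢L₂ = proj₁ (proj₂ hex₃)
    M₃≢L₃ = proj₂ (proj₂ hex₃)

    y₀≁x₂ : y₀ ≁ x₂
    y₀≁x₂ = apex-≁-third (exchange o₁) y₀-apex
      where
      y₀-apex = record { e~x = ~-sym O₀.b~c ; e~y = ~-sym Y₁.e~y
                       ; e∉l = off-second-line (≢-sym L₁≢L₀) O₀.b∈ O₁.a∈ O₀.c∈ (≢-sym O₀.b≢c)
                       }

    y₁≁x₀ : y₁ ≁ x₀
    y₁≁x₀ = apex-≁-third (rotate o₀) Y₁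

    x₀≢x₂ : x₀ ≢ x₂
    x₀≢x₂ x₀≡x₂ = y₀≁x₂ (subst (y₀ ~_) x₀≡x₂ (~-sym O₀.a~c))

    m₁∉L₀ : m₁ ∉ L₀
    m₁∉L₀ = off-second-line M₁≢L₀ S₁.a∈ O₀.b∈ S₁.b∈ (≢-sym S₁.a≢b)

    m₁≁x₀ : m₁ ≁ x₀
    m₁≁x₀ m₁~x₀ = S₁.b≢c (apex-unique O₀.a∈ O₀.b∈ O₀.a~b m₁-apex (Apex-swap Am₀))
      where m₁-apex = record { e~x = m₁~x₀ ; e~y = Am₁.e~x ; e∉l = m₁∉L₀ }

    m₂≁x₀ : m₂ ≁ x₀
    m₂≁x₀ m₂~x₀ = no-three-common x₀≢m₁ S₁.a≢c x₁≢m₂ m₀≢m₂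
                    (~-sym O₀.a~b) S₁.a~b Am₀.e~y (~-sym S₁.b~c) m₂~x₀ S₂.b~c
      where
      x₀≢m₁ : x₀ ≢ m₁
      x₀≢m₁ x₀≡m₁ = m₁∉L₀ (subst (_∈ L₀) x₀≡m₁ O₀.a∈)
      x₁≢m₂ : x₁ ≢ m₂
      x₁≢m₂ x₁≡m₂ = off-second-line (≢-sym M₂≢L₁) O₁.b∈ S₂.a∈ O₁.a∈ O₁.a≢b
                                    (subst (_∈ M₂) (sym x₁≡m₂) S₂.b∈)
      m₀≢m₂ : m₀ ≢ m₂
      m₀≢m₂ m₀≡m₂ = S₁.b≢c (sym (apex-unique O₁.a∈ O₁.b∈ O₁.a~b m₀-apex Am₁))
        where
        m₀-apex = record { e~x = Am₀.e~x ; e~y = subst (_~ x₂) (sym m₀≡m₂) (Apex.e~x (apex-of-line o₂))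
                         ; e∉l = off-second-line M₁≢L₁ S₁.a∈ O₁.a∈ S₁.c∈ (≢-sym S₁.a≢c) }

    y₂≁x₀ : y₂ ≁ x₀
    y₂≁x₀ y₂~x₀ = no-three-common x₀≢y₁ O₀.b≢c x₁≢y₂ y₀≢y₂
                    (~-sym O₀.a~b) O₁.a~c (~-sym O₀.a~c) (~-sym Y₁.e~y) y₂~x₀ Y₂.e~y
      where
      x₀≢y₁ : x₀ ≢ y₁
      x₀≢y₁ x₀≡y₁ = Y₁.e∉l (subst (_∈ L₀) x₀≡y₁ O₀.a∈)
      x₁≢y₂ : x₁ ≢ y₂
      x₁≢y₂ x₁≡y₂ = Y₂.e∉l (subst (_∈ L₁) x₁≡y₂ O₁.a∈)
      y₀≢y₂ : y₀ ≢ y₂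
      y₀≢y₂ y₀≡y₂ = y₀≁x₂ (subst (_~ x₂) (sym y₀≡y₂) Y₂.e~x)

    -- μ = 2: x₀ and x₂ have a common neighbour z besides x₁, and every candidate other than x₃
    -- is excluded.
    x₃~x₀ : x₃ ~ x₀
    x₃~x₀ = subst (_~ x₀) z≡x₃ z~x₀
      where
      z = apex x₀ x₂ x₁
      z-facts = apex-spec x₀≢x₂ (~-sym O₀.a~b) O₁.a~b
      z~x₀ = proj₁ z-facts
      z~x₂ = proj₁ (proj₂ z-facts)
      not-z : ∀ {u} → u ≁ x₀ → z ≢ u
      not-z u≁x₀ z≡u = u≁x₀ (subst (_~ x₀) z≡u z~x₀)
      z∈L₂ : z ∈ L₂
      z∈L₂ = on-last-line O₁.b∈ S₂.a∈ O₂.a∈ (≢-sym M₂≢L₁) (≢-sym L₂≢L₁) M₂≢L₂ z~x₂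
               (off-line o₁ (proj₂ (proj₂ z-facts)) (~⇒≢ z~x₂) (not-z y₁≁x₀))
               (off-line star₂ (~⇒≢ z~x₂) (not-z m₂≁x₀) (not-z m₁≁x₀))
      z≡x₃ : z ≡ x₃
      z≡x₃ = on-line-last (exchange o₂) z∈L₂ (~⇒≢ z~x₂) (not-z y₂≁x₀)

    x₀∈L₃ : x₀ ∈ L₃
    x₀∈L₃ = on-last-line O₂.b∈ (OnLine.a∈ star₃) O₃.a∈ (≢-sym M₃≢L₂) L₂≢L₃ M₃≢L₃ (~-sym x₃~x₀)
                         x₀∉L₂ x₀∉M₃
      where
      x₀∉L₂ : x₀ ∉ L₂
      x₀∉L₂ = off-line o₂ x₀≢x₂ (~⇒≢ (~-sym x₃~x₀))
                       (λ x₀≡y₂ → y₁≁x₀ (subst (y₁ ~_) (sym x₀≡y₂) (~-sym Y₂.e~y)))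
      x₀≢m₂ : x₀ ≢ m₂
      x₀≢m₂ x₀≡m₂ = m₁≁x₀ (subst (m₁ ~_) (sym x₀≡m₂) (~-sym S₂.b~c))
      x₀∉M₃ : x₀ ∉ M₃
      x₀∉M₃ x₀∈M₃ = m₂≁x₀ (collinear⇒~ (OnLine.b∈ star₃) x₀∈M₃ (≢-sym x₀≢m₂))

    x₄≡x₀ : x₄ ≡ x₀
    x₄≡x₀ = sym (on-line-last (exchange o₃) x₀∈L₃ (≢-sym (~⇒≢ x₃~x₀))
                               (λ x₀≡y₃ → y₂≁x₀ (subst (y₂ ~_) (sym x₀≡y₃) (~-sym Y₃.e~y))))

  stepEast⁴ : Frame → Frame
  stepEast⁴ F = stepEast (stepEast (stepEast (stepEast F)))

  stepNorth⁴ : Frame → Frame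
  stepNorth⁴ F = stepNorth (stepNorth (stepNorth (stepNorth F)))

  stepEast⁴-origin : ∀ {F} → Valid F → origin (stepEast⁴ F) ≡ origin F
  stepEast⁴-origin o₀ = Strip.x₄≡x₀ o₀ o₁ o₂ (stepEast-valid o₂) refl refl refl
    where
    o₁ = stepEast-valid o₀
    o₂ = stepEast-valid o₁

  stepEast⁴-id : ∀ {F} → Valid F → stepEast⁴ F ≡ F
  stepEast⁴-id {F} o = frame-≡ x₄≡x₀ L₄≡L₀ x₅≡x₁ y₄≡y₀
    where
    H = stepEast⁴ F
    h : Valid H
    h = stepEast-valid (stepEast-valid (stepEast-valid (stepEast-valid o)))
    x₄≡x₀ : origin H ≡ origin F
    x₄≡x₀ = stepEast⁴-origin o
    x₅≡x₁ : east H ≡ east F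
    x₅≡x₁ = stepEast⁴-origin (stepEast-valid o)
    L₄≡L₀ : line H ≡ line F
    L₄≡L₀ = line-unique (OnLine.a≢b o) (subst (_∈ line H) x₄≡x₀ (OnLine.a∈ h))
                        (subst (_∈ line H) x₅≡x₁ (OnLine.b∈ h)) (OnLine.a∈ o) (OnLine.b∈ o)
    y₄≡y₀ : north H ≡ north F
    y₄≡y₀ = on-line-last o (subst (north H ∈_) L₄≡L₀ (OnLine.c∈ h))
              (λ y₄≡x₀ → OnLine.a≢c h (trans x₄≡x₀ (sym y₄≡x₀)))
              (λ y₄≡x₁ → OnLine.b≢c h (trans x₅≡x₁ (sym y₄≡x₁)))

  stepNorth⁴-id : ∀ {F} → Valid F → stepNorth⁴ F ≡ F
  stepNorth⁴-id o = cong flip (stepEast⁴-id (exchange o))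

  fold-valid : ∀ {F} (step : Frame → Frame) → (∀ {G} → Valid G → Valid (step G)) →
               ∀ k → Valid F → Valid (fold F step k)
  fold-valid step step-valid zero    o = o
  fold-valid step step-valid (suc k) o = step-valid (fold-valid step step-valid k o)

  stepNorth-fold-stepEast : ∀ {F} k → Valid F → stepNorth (fold F stepEast k) ≡ fold (stepNorth F) stepEast k
  stepNorth-fold-stepEast zero    o = refl
  stepNorth-fold-stepEast (suc k) o =
    trans (sym (steps-commute (fold-valid stepEast stepEast-valid k o)))
          (cong stepEast (stepNorth-fold-stepEast k o))

  module _ where
    private
      x : Point
      x = zero
      l : Line
      l = choose (I x)
      x∈l : x ∈ l
      x∈l = choose-count (I x) (point-deg x)
      on-l : Point → Bool
      on-l w = I w l
      p : Point
      p = choose (on-l without x)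
      p-facts : p ∈ l × p ≢ x
      p-facts = without-sound on-l (choose-count (on-l without x) (count-without-pred on-l x∈l (line-size l)))

    someFrame : Frame
    someFrame = frame x l p (third l x p)

    someFrame-valid : Valid someFrame
    someFrame-valid = third-spec x∈l (proj₁ p-facts) (≢-sym (proj₂ p-facts))

-- The torus configuration: point and line (i, j) of Z₄ × Z₄ are numbered combine i j, and line l
-- consists of l, right l = l + (1, 0) and up l = l + (0, 1).

next : Fin 4 → Fin 4
next zero                   = suc zero
next (suc zero)             = suc (suc zero)
next (suc (suc zero))       = suc (suc (suc zero))
next (suc (suc (suc zero))) = zero

right up : Fin 16 → Fin 16
right p = uncurry (λ i j → combine (next i) j) (remQuot {4} 4 p)
up    p = uncurry (λ i j → combine i (next j)) (remQuot {4} 4 p)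

Torus : Incidence 16
Torus p l = does (p ≟ l) ∨ does (p ≟ right l) ∨ does (p ≟ up l)

Torus-true : ∀ {p l} → Torus p l ≡ true → p ≡ l ⊎ p ≡ right l ⊎ p ≡ up l
Torus-true {p} {l} e with p ≟ l | p ≟ right l | p ≟ up l
... | yes p≡l | _          | _        = inj₁ p≡l
... | no _    | yes p≡rl   | _        = inj₂ (inj₁ p≡rl)
... | no _    | no _       | yes p≡ul = inj₂ (inj₂ p≡ul)

Torus-false : ∀ {p l} → Torus p l ≡ false → p ≢ l × p ≢ right l × p ≢ up l
Torus-false {p} {l} e with p ≟ l | p ≟ right l | p ≟ up l
... | no p≢l | no p≢rl | no p≢ul = p≢l , p≢rl , p≢ul

-- corner r = r - (1, 1), so that the lines through r are up (corner r), right (corner r) and r.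
corner : Fin 16 → Fin 16
corner r = right (right (right (up (up (up r)))))

Collinear : Fin 16 → Fin 16 → Set
Collinear p q = Σ (Fin 16) λ l → Torus p l ≡ true × Torus q l ≡ true

opaque
  Torus-pencil : ∀ r l → Torus r l ≡ true →
                 l ≡ up (corner r) ⊎ l ≡ right (corner r) ⊎ l ≡ right (up (corner r))
  Torus-pencil = toWitness {a? = all? λ r → all? λ l → (Torus r l 𝔹.≟ true) →-dec
                   ((l ≟ up (corner r)) ⊎-dec (l ≟ right (corner r)) ⊎-dec (l ≟ right (up (corner r))))} _

  Torus-diameter-two : ∀ p q → Collinear p q ⊎ Σ (Fin 16) λ r → Collinear p r × Collinear r q
  Torus-diameter-two = toWitness {a? = all? λ p → all? λ q →
                         collinear? p q ⊎-dec any? λ r → collinear? p r ×-dec collinear? r q} _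
    where
    collinear? : ∀ p q → Dec (Collinear p q)
    collinear? p q = any? λ l → (Torus p l 𝔹.≟ true) ×-dec (Torus q l 𝔹.≟ true)

  Torus-lines-distinct : ∀ l m → Torus l m ≡ true → Torus (right l) m ≡ true → Torus (up l) m ≡ true →
                         l ≡ m
  Torus-lines-distinct = toWitness {a? = all? λ l → all? λ m →
                           (Torus l m 𝔹.≟ true) →-dec (Torus (right l) m 𝔹.≟ true) →-dec
                           (Torus (up l) m 𝔹.≟ true) →-dec (l ≟ m)} _

Torus-SR : IsSRConfiguration 16 3 2 2 Torus
Torus-SR = record
  { configuration = record
    { line-size        = toWitness {a? = all? λ l → count (λ p → Torus p l) ℕ.≟ 3} _
    ; point-deg        = toWitness {a? = all? λ p → count (Torus p) ℕ.≟ 3} _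
    ; at-most-one-line = toWitness {a? = all? λ p → all? λ q →
                           ¬? (p ≟ q) →-dec count (λ l → Torus p l ∧ Torus q l) ℕ.≤? 1} _
    }
  ; srg = record
    { irreflexive        = irreflexive
    ; symmetric          = toWitness {a? = all? λ x → all? λ y →
                             pointGraph Torus x y 𝔹.≟ pointGraph Torus y x} _
    ; regular            = toWitness {a? = all? λ x → count (pointGraph Torus x) ℕ.≟ 6} _
    ; adjacent-common    = λ x y x~y → common-two x y (adjacent⇒≢ x~y)
    ; nonadjacent-common = λ x y x≢y _ → common-two x y x≢y
    }
  }
  where
  irreflexive : ∀ x → pointGraph Torus x x ≡ false
  irreflexive = toWitness {a? = all? λ x → pointGraph Torus x x 𝔹.≟ false} _
  adjacent⇒≢ : ∀ {x y} → pointGraph Torus x y ≡ true → x ≢ y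
  adjacent⇒≢ {x} x~x refl with () ← trans (sym x~x) (irreflexive x)
  common-two : ∀ x y → x ≢ y → count (λ z → pointGraph Torus x z ∧ pointGraph Torus y z) ≡ 2
  common-two = toWitness {a? = all? λ x → all? λ y → ¬? (x ≟ y) →-dec
                            count (λ z → pointGraph Torus x z ∧ pointGraph Torus y z) ℕ.≟ 2} _

-- Coordinates on a strongly regular (16₃; 2, 2) configuration

module Coordinates {I : Incidence 16} (C : IsSRConfiguration 16 3 2 2 I) where
  open Geometry I C

  grid : Fin 4 → Fin 4 → Frame
  grid i j = fold (fold someFrame stepNorth (toℕ j)) stepEast (toℕ i)

  grid-valid : ∀ i j → Valid (grid i j)
  grid-valid i j =
    fold-valid stepEast stepEast-valid (toℕ i) (fold-valid stepNorth stepNorth-valid (toℕ j) someFrame-valid)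

  grid-next-i : ∀ i j → grid (next i) j ≡ stepEast (grid i j)
  grid-next-i zero                   j = refl
  grid-next-i (suc zero)             j = refl
  grid-next-i (suc (suc zero))       j = refl
  grid-next-i (suc (suc (suc zero))) j = sym (stepEast⁴-id (grid-valid zero j))

  grid-next-j : ∀ i j → grid i (next j) ≡ stepNorth (grid i j)
  grid-next-j i j = trans (cong (λ F → fold F stepEast (toℕ i)) (column j))
                          (sym (stepNorth-fold-stepEast (toℕ i) (grid-valid zero j)))
    where
    column : ∀ j → grid zero (next j) ≡ stepNorth (grid zero j)
    column zero                   = refl
    column (suc zero)             = refl
    column (suc (suc zero))       = refl
    column (suc (suc (suc zero))) = sym (stepNorth⁴-id someFrame-valid)

  frameAt : Fin 16 → Frame
  frameAt p = uncurry grid (remQuot {4} 4 p)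

  frameAt-valid : ∀ p → Valid (frameAt p)
  frameAt-valid p = grid-valid (proj₁ (remQuot {4} 4 p)) (proj₂ (remQuot {4} 4 p))

  frameAt-right : ∀ p → frameAt (right p) ≡ stepEast (frameAt p)
  frameAt-right p = trans (cong (uncurry grid) (remQuot-combine {4} {4} (next i) j)) (grid-next-i i j)
    where
    i = proj₁ (remQuot {4} 4 p)
    j = proj₂ (remQuot {4} 4 p)

  frameAt-up : ∀ p → frameAt (up p) ≡ stepNorth (frameAt p)
  frameAt-up p = trans (cong (uncurry grid) (remQuot-combine {4} {4} i (next j))) (grid-next-j i j)
    where
    i = proj₁ (remQuot {4} 4 p)
    j = proj₂ (remQuot {4} 4 p)

  σ : Fin 16 → Point
  σ p = origin (frameAt p)

  τ : Fin 16 → Line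
  τ l = line (frameAt l)

  line-points : ∀ l → OnLine (τ l) (σ l) (σ (right l)) (σ (up l))
  line-points l = subst₂ (OnLine (τ l) (σ l)) (sym (cong origin (frameAt-right l)))
                         (sym (cong origin (frameAt-up l))) (frameAt-valid l)

  incidence : ∀ {p l} → Torus p l ≡ true → σ p ∈ τ l
  incidence {p} {l} e = [ (λ p≡l → subst (λ u → σ u ∈ τ l) (sym p≡l) a∈)
                        , [ (λ p≡rl → subst (λ u → σ u ∈ τ l) (sym p≡rl) b∈)
                          , (λ p≡ul → subst (λ u → σ u ∈ τ l) (sym p≡ul) c∈) ]′ ]′
                          (Torus-true {p} {l} e)
    where open OnLine (line-points l)

  σ-collinear-injective : ∀ {p q l} → Torus p l ≡ true → Torus q l ≡ true → σ p ≡ σ q → p ≡ q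
  σ-collinear-injective {p} {q} {l} p∈l q∈l =
    injective-on-three σ {l} {right l} {up l} a≢b a≢c b≢c (Torus-true {p} {l} p∈l) (Torus-true {q} {l} q∈l)
    where open OnLine (line-points l)

  τ-pencil-injective : ∀ {r l m} → Torus r l ≡ true → Torus r m ≡ true → τ l ≡ τ m → l ≡ m
  τ-pencil-injective {r} r∈l r∈m = injective-on-three τ {up k} {right k} {right (up k)}
    (subst₂ _≢_ (sym eU) (sym eR) (≢-sym (proj₁ distinct)))
    (subst₂ _≢_ (sym eU) (sym eRU) (≢-sym (proj₂ (proj₂ distinct))))
    (subst₂ _≢_ (sym eR) (sym eRU) (≢-sym (proj₁ (proj₂ distinct))))
    (Torus-pencil r _ r∈l) (Torus-pencil r _ r∈m)
    where
    k = corner r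
    F = frameAt k
    distinct = square-lines-distinct (frameAt-valid k)
    eR : τ (right k) ≡ line (stepEast F)
    eR = cong line (frameAt-right k)
    eU : τ (up k) ≡ line (stepNorth F)
    eU = cong line (frameAt-up k)
    eRU : τ (right (up k)) ≡ line (stepEast (stepNorth F))
    eRU = trans (cong line (frameAt-right (up k))) (cong (λ G → line (stepEast G)) (frameAt-up k))

  σ-injective : ∀ {p q} → σ p ≡ σ q → p ≡ q
  σ-injective {p} {q} σp≡σq with Torus-diameter-two p q
  ... | inj₁ (l , p∈l , q∈l) = σ-collinear-injective {p} {q} {l} p∈l q∈l σp≡σq
  ... | inj₂ (r , (l , p∈l , r∈l) , (m , r∈m , q∈m)) with σ p ≟ σ r
  ...   | yes σp≡σr = trans (σ-collinear-injective {p} {r} {l} p∈l r∈l σp≡σr)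
                            (σ-collinear-injective {r} {q} {m} r∈m q∈m (trans (sym σp≡σr) σp≡σq))
  ...   | no  σp≢σr =
    σ-collinear-injective {p} {q} {l} p∈l (subst (λ n → Torus q n ≡ true) (sym l≡m) q∈m) σp≡σq
    where
    l≡m : l ≡ m
    l≡m = τ-pencil-injective {r} {l} {m} r∈l r∈m
            (line-unique σp≢σr (incidence {p} {l} p∈l) (incidence {r} {l} r∈l)
                         (subst (_∈ τ m) (sym σp≡σq) (incidence {q} {m} q∈m)) (incidence {r} {m} r∈m))

  preserves : ∀ p l → I (σ p) (τ l) ≡ Torus p l
  preserves p l with Torus p l in e
  ... | true  = incidence {p} {l} e
  ... | false = ¬-not (off-line (line-points l) (λ eq → p≢l (σ-injective {p} {l} eq))
                                                (λ eq → p≢rl (σ-injective {p} {right l} eq))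
                                                (λ eq → p≢ul (σ-injective {p} {up l} eq)))
    where
    p≢l = proj₁ (Torus-false {p} {l} e)
    p≢rl = proj₁ (proj₂ (Torus-false {p} {l} e))
    p≢ul = proj₂ (proj₂ (Torus-false {p} {l} e))

  τ-injective : ∀ {l m} → τ l ≡ τ m → l ≡ m
  τ-injective {l} {m} τl≡τm = Torus-lines-distinct l m (on-m {l} a∈) (on-m {right l} b∈) (on-m {up l} c∈)
    where
    open OnLine (line-points l)
    on-m : ∀ {u} → σ u ∈ τ l → Torus u m ≡ true
    on-m {u} u∈l = trans (sym (preserves u m)) (subst (σ u ∈_) τl≡τm u∈l)

  Torus-isomorphic : Isomorphic Torus I
  Torus-isomorphic = record
    { onPoints  = injective⇒↔ σ σ-injective
    ; onLines   = injective⇒↔ τ τ-injective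
    ; preserves = preserves
    }

corollary20 : Σ (Incidence 16) (IsSRConfiguration 16 3 2 2)
              × (∀ (I J : Incidence 16) → IsSRConfiguration 16 3 2 2 I →
                   IsSRConfiguration 16 3 2 2 J → Isomorphic I J)
corollary20 = (Torus , Torus-SR) , λ I J I-SR J-SR →
  Isomorphic-trans (Isomorphic-sym (Coordinates.Torus-isomorphic I-SR)) (Coordinates.Torus-isomorphic J-SR)
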